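{- Let $G$ be a finite graph without loops and parallel edges, and let $N_1$ and $N_2$ be two numerations of the edges of $G$. Then $\chi_{MA(G,N_1)}(t)=\chi_{MA(G,N_2)}(t)$.
   Context: For $G=(V,E)$ with $|E|=n$, a numeration is a bijection $N:E\to\{1,\dots,n\}$. Let $F$ be the set of all sequences of edges $(r_1,\dots,r_k)$ ($k\ge1$) forming a simple path in $G$, or a simple cycle of $G$ with an even number of edges. Each such sequence gives the hyperplane $x_{N(r_1)}-x_{N(r_2)}+\dots+(-1)^{k+1}x_{N(r_k)}=0$ in $\mathbb{R}^n$; the matching arrangement $MA(G,N)$ is the set of all these hyperplanes. For a hyperplane arrangement $A$ in $\mathbb{R}^n$, $L(A)$ is the poset of all nonempty intersections of subsets of hyperplanes of $A$ (including $\mathbb{R}^n$ as the empty intersection), ordered by reverse inclusion, with minimum $\hat0=\mathbb{R}^n$; $\mu$ is its Möbius function and $\mu(x)=\mu(\hat0,x)$. The characteristic polynomial is $\chi_A(t)=\sum_{x\in L(A)}\mu(x)t^{\dim x}$.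
   Formalization: The hyperplanes of the matching arrangement, the intersections in L(A) and their dimensions are taken in ℚ^n rather than $\mathbb{R}^n$. -}

module Defs where

open import Data.Nat as ℕ using (ℕ; zero; suc; _≥_; _≡ᵇ_)
open import Data.Nat.Divisibility using (_∣_)
open import Data.Integer as ℤ using (ℤ)
open import Data.Rational as ℚ using (ℚ; 0ℚ; 1ℚ)
open import Data.Fin using (Fin; zero; suc; toℕ; inject₁; fromℕ; _≟_)
open import Data.Product using (Σ; ∃; _×_; _,_; proj₁; proj₂)
open import Data.Sum using (_⊎_)
open import Data.List using (List)
open import Data.List.Relation.Unary.All using (All)
open import Data.Bool using (Bool; true; if_then_else_)
open import Relation.Nullary using (¬_; Dec; does)
open import Relation.Binary.PropositionalEquality using (_≡_; _≢_)
open import Function.Definitions using (Injective)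

sumℚ : ∀ {k} → (Fin k → ℚ) → ℚ
sumℚ {zero}  f = 0ℚ
sumℚ {suc k} f = f zero ℚ.+ sumℚ (λ i → f (suc i))

sumℤ : ∀ {k} → (Fin k → ℤ) → ℤ
sumℤ {zero}  f = ℤ.0ℤ
sumℤ {suc k} f = f zero ℤ.+ sumℤ (λ i → f (suc i))

-- Finite simple graphs: vertices Fin V, edges Fin n (an arbitrary
-- labelling used only to represent the edge set), no loops, no parallel
-- edges.

Joins : ∀ {V} → Fin V × Fin V → Fin V → Fin V → Set
Joins e u w = (e ≡ (u , w)) ⊎ (e ≡ (w , u))

record SimpleGraph : Set where
  field
    V        : ℕ
    nE       : ℕ
    ends     : Fin nE → Fin V × Fin V
    loopless : ∀ e → proj₁ (ends e) ≢ proj₂ (ends e)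
    simple   : ∀ e f → Joins (ends f) (proj₁ (ends e)) (proj₂ (ends e)) → e ≡ f

open SimpleGraph public

-- A numeration is a bijection E → {1,…,n}; with E represented by Fin n
-- and {1,…,n} by Fin n (coordinate i+1 ↔ index i).
Numeration : SimpleGraph → Set
Numeration G = Fin (nE G) → Fin (nE G)

IsWalk : (G : SimpleGraph) (k : ℕ) → (Fin k → Fin (nE G)) → (Fin (suc k) → Fin (V G)) → Set
IsWalk G k r v = ∀ i → Joins (ends G (r i)) (v (inject₁ i)) (v (suc i))

IsSimplePath : (G : SimpleGraph) (k : ℕ) → (Fin k → Fin (nE G)) → Set
IsSimplePath G k r =
  k ≥ 1 × Σ (Fin (suc k) → Fin (V G)) (λ v → IsWalk G k r v × Injective _≡_ _≡_ v)

-- (r₁,…,r_k) is a simple cycle with an even number of edges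
-- (a simple cycle in a simple graph has k ≥ 3 distinct vertices)
IsEvenSimpleCycle : (G : SimpleGraph) (k : ℕ) → (Fin k → Fin (nE G)) → Set
IsEvenSimpleCycle G k r =
  k ≥ 3 × 2 ∣ k ×
  Σ (Fin (suc k) → Fin (V G)) (λ v →
       IsWalk G k r v × v (fromℕ k) ≡ v zero
     × Injective _≡_ _≡_ (λ (i : Fin k) → v (inject₁ i)))

InF : (G : SimpleGraph) (k : ℕ) → (Fin k → Fin (nE G)) → Set
InF G k r = IsSimplePath G k r ⊎ IsEvenSimpleCycle G k r

-- Linear algebra over ℚ (all hyperplanes have integer coefficients).

Vecℚ : ℕ → Set
Vecℚ n = Fin n → ℚ

dot : ∀ {n} → Vecℚ n → Vecℚ n → ℚ
dot a x = sumℚ (λ j → a j ℚ.* x j)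

Subset : ℕ → Set₁
Subset n = Vecℚ n → Set

_⊆_ : ∀ {n} → Subset n → Subset n → Set
X ⊆ Y = ∀ x → X x → Y x

_≃_ : ∀ {n} → Subset n → Subset n → Set
X ≃ Y = (X ⊆ Y) × (Y ⊆ X)

Full : ∀ {n} → Subset n
Full x = Data.Unit.⊤
  where import Data.Unit

lincomb : ∀ {n d} → (Fin d → ℚ) → (Fin d → Vecℚ n) → Vecℚ n
lincomb c b j = sumℚ (λ i → c i ℚ.* b i j)

HasDim : ∀ {n} → Subset n → ℕ → Set
HasDim {n} X d = Σ (Fin d → Vecℚ n) λ b →
    (∀ i → X (b i))
  × (∀ c → (∀ j → lincomb c b j ≡ 0ℚ) → ∀ i → c i ≡ 0ℚ)
  × (∀ x → X x → Σ (Fin d → ℚ) λ c → ∀ j → x j ≡ lincomb c b j)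

-- Hyperplane arrangements (central; hyperplane {x | a·x = 0} given by
-- its normal vector a). An arrangement is given by the predicate
-- "a is a normal vector of one of its hyperplanes".

Arrangement : ℕ → Set₁
Arrangement n = Vecℚ n → Set

Inter : ∀ {n} → List (Vecℚ n) → Subset n
Inter as x = All (λ a → dot a x ≡ 0ℚ) as

InL : ∀ {n} → Arrangement n → Subset n → Set
InL {n} A X = Σ (List (Vecℚ n)) λ as → All A as × (X ≃ Inter as)

-- IsCharPoly A p : p d is the coefficient of t^d in χ_A(t)
-- = Σ_{x ∈ L(A)} μ(0̂,x) t^{dim x}.
-- Witness: an enumeration without repetition of L(A), the order of L(A)
-- (reverse inclusion) as a decidable table, dimensions, and the Möbius
-- function given by its defining recursion μ(0̂)=1,
-- Σ_{0̂ ≤ y ≤ x} μ(y) = 0 for x ≠ 0̂.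
record IsCharPoly {n} (A : Arrangement n) (p : ℕ → ℤ) : Set₁ where
  field
    m         : ℕ
    flat      : Fin m → Subset n
    flat-in   : ∀ i → InL A (flat i)
    flat-all  : ∀ X → InL A X → Σ (Fin m) λ i → X ≃ flat i
    flat-inj  : ∀ i j → flat i ≃ flat j → i ≡ j
    le        : Fin m → Fin m → Bool
    le-sound  : ∀ i j → le i j ≡ true → flat j ⊆ flat i
    le-compl  : ∀ i j → flat j ⊆ flat i → le i j ≡ true
    dim       : Fin m → ℕ
    dim-ok    : ∀ i → HasDim (flat i) (dim i)
    μ         : Fin m → ℤ
    μ-bot     : ∀ i → flat i ≃ Full → μ i ≡ ℤ.1ℤ
    μ-rec     : ∀ j → ¬ (flat j ≃ Full) →
                sumℤ (λ i → if le i j then μ i else ℤ.0ℤ) ≡ ℤ.0ℤ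
    coeff     : ∀ d → p d ≡ sumℤ (λ i → if dim i ≡ᵇ d then μ i else ℤ.0ℤ)

sgn : ℕ → ℚ
sgn zero    = 1ℚ
sgn (suc i) = ℚ.- sgn i

altForm : (G : SimpleGraph) → Numeration G → (k : ℕ) → (Fin k → Fin (nE G)) → Vecℚ (nE G)
altForm G N k r j = sumℚ (λ i → sgn (toℕ i) ℚ.* (if does (N (r i) ≟ j) then 1ℚ else 0ℚ))

MA : (G : SimpleGraph) → Numeration G → Arrangement (nE G)
MA G N a = Σ ℕ λ k → Σ (Fin k → Fin (nE G)) λ r →
  InF G k r × (∀ j → a j ≡ altForm G N k r j)

-- Renumbering the edges only permutes coordinates: a ↦ a ∘ N₁ ∘ N₂⁻¹ maps MA(G,N₁) onto
-- MA(G,N₂). A coordinate permutation maps intersections of hyperplanes to intersections of the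
-- permuted hyperplanes, so it induces an isomorphism of the intersection posets that preserves
-- dimension. The Möbius function is determined by the order through its defining recursion,
-- hence is transported as well, and every coefficient of χ is preserved.

module Submission where

open import Defs
open import Algebra.Bundles using (AbelianGroup; CommutativeRing)
import Algebra.Properties.Group as GroupProperties
import Algebra.Properties.Semiring.Sum as SemiringSum
open import Data.Bool using (Bool; true; false; if_then_else_)
open import Data.Fin using (Fin; zero; suc; toℕ; punchIn; _≟_)
open import Data.Fin.Permutation
  using (Permutation; _⟨$⟩ʳ_; _⟨$⟩ˡ_; inverseˡ; inverseʳ; permutation; flip; _∘ₚ_)
open import Data.Fin.Properties using (punchInᵢ≢i)
import Data.Fin.Subset as Fs
open import Data.Fin.Subset.Properties using (p⊂q⇒∣p∣<∣q∣)
open import Data.Integer as ℤ using (ℤ)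
import Data.Integer.Properties as ℤP
open import Data.List using (List; []; map)
import Data.List.Relation.Unary.All as All
open import Data.List.Relation.Unary.All.Properties using (map⁺; map⁻)
open import Data.Nat as ℕ using (ℕ; zero; suc; _≡ᵇ_; _<_)
open import Data.Nat.Induction using (<-wellFounded)
open import Data.Product using (_×_; _,_; proj₁; proj₂)
open import Data.Rational as ℚ using (ℚ; 0ℚ; 1ℚ)
import Data.Rational.Properties as ℚP
open import Data.Unit using (tt)
open import Data.Vec using (tabulate)
open import Data.Vec.Properties using (lookup⇒[]=; []=⇒lookup; lookup∘tabulate)
open import Function using (_∘_; _on_; Injection)
open import Function.Bundles using (mk⤖; mk⇔)
open import Function.Definitions using (Bijective; Injective)
open import Function.Properties.Bijection using (⤖⇒↔)
open import Function.Properties.Inverse using (↔⇒↣)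
open import Induction.WellFounded using (WellFounded)
import Induction.WellFounded as WF
import Relation.Binary.Construct.On as On
open import Relation.Binary.Definitions using (_Respects_)
open import Relation.Nullary using (does; yes; no; contradiction)
open import Relation.Nullary.Decidable using (does-⇔; dec-true; dec-false)
open import Relation.Binary.PropositionalEquality
open ≡-Reasoning

module ΣQ = SemiringSum (CommutativeRing.semiring ℚP.+-*-commutativeRing)
module ΣZ = SemiringSum ℤP.+-*-semiring

sumℚ≗sum : ∀ {k} (f : Fin k → ℚ) → sumℚ f ≡ ΣQ.sum f
sumℚ≗sum {zero}  f = refl
sumℚ≗sum {suc k} f = cong (f zero ℚ.+_) (sumℚ≗sum (f ∘ suc))

sumℤ≗sum : ∀ {k} (f : Fin k → ℤ) → sumℤ f ≡ ΣZ.sum f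
sumℤ≗sum {zero}  f = refl
sumℤ≗sum {suc k} f = cong (ℤ._+_ (f zero)) (sumℤ≗sum (f ∘ suc))

sumℚ-via-sum : ∀ {k l} (f : Fin k → ℚ) (g : Fin l → ℚ) → ΣQ.sum f ≡ ΣQ.sum g → sumℚ f ≡ sumℚ g
sumℚ-via-sum f g eq = trans (sumℚ≗sum f) (trans eq (sym (sumℚ≗sum g)))

sumℤ-via-sum : ∀ {k l} (f : Fin k → ℤ) (g : Fin l → ℤ) → ΣZ.sum f ≡ ΣZ.sum g → sumℤ f ≡ sumℤ g
sumℤ-via-sum f g eq = trans (sumℤ≗sum f) (trans eq (sym (sumℤ≗sum g)))

sumℚ-cong : ∀ {k} {f g : Fin k → ℚ} → f ≗ g → sumℚ f ≡ sumℚ g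
sumℚ-cong {f = f} {g} f≗g = sumℚ-via-sum f g (ΣQ.sum-cong-≗ f≗g)

sumℤ-cong : ∀ {k} {f g : Fin k → ℤ} → f ≗ g → sumℤ f ≡ sumℤ g
sumℤ-cong {f = f} {g} f≗g = sumℤ-via-sum f g (ΣZ.sum-cong-≗ f≗g)

sumℚ-permute : ∀ {m n} (f : Fin n → ℚ) (π : Permutation m n) → sumℚ f ≡ sumℚ (f ∘ (π ⟨$⟩ʳ_))
sumℚ-permute f π = sumℚ-via-sum f (f ∘ (π ⟨$⟩ʳ_)) (ΣQ.sum-permute f π)

sumℤ-permute : ∀ {m n} (f : Fin n → ℤ) (π : Permutation m n) → sumℤ f ≡ sumℤ (f ∘ (π ⟨$⟩ʳ_))
sumℤ-permute f π = sumℤ-via-sum f (f ∘ (π ⟨$⟩ʳ_)) (ΣZ.sum-permute f π)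

sumℚ-comm : ∀ {m n} (f : Fin m → Fin n → ℚ) →
            sumℚ (λ i → sumℚ (f i)) ≡ sumℚ (λ j → sumℚ (λ i → f i j))
sumℚ-comm f = begin
  sumℚ (λ i → sumℚ (f i))             ≡⟨ sumℚ-cong (λ i → sumℚ≗sum (f i)) ⟩
  sumℚ (λ i → ΣQ.sum (f i))           ≡⟨ sumℚ-via-sum (λ i → ΣQ.sum (f i)) (λ j → ΣQ.sum (λ i → f i j)) (ΣQ.∑-comm f) ⟩
  sumℚ (λ j → ΣQ.sum (λ i → f i j))   ≡⟨ sumℚ-cong (λ j → sumℚ≗sum (λ i → f i j)) ⟨
  sumℚ (λ j → sumℚ (λ i → f i j))     ∎

sumℚ-*ˡ : ∀ {k} x (f : Fin k → ℚ) → x ℚ.* sumℚ f ≡ sumℚ (λ i → x ℚ.* f i)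
sumℚ-*ˡ x f = trans (cong (x ℚ.*_) (sumℚ≗sum f))
                    (trans (ΣQ.*-distribˡ-sum x f) (sym (sumℚ≗sum (λ i → x ℚ.* f i))))

sumℚ-*ʳ : ∀ {k} x (f : Fin k → ℚ) → sumℚ f ℚ.* x ≡ sumℚ (λ i → f i ℚ.* x)
sumℚ-*ʳ x f = trans (cong (ℚ._* x) (sumℚ≗sum f))
                    (trans (ΣQ.*-distribʳ-sum x f) (sym (sumℚ≗sum (λ i → f i ℚ.* x))))

sumℚ-+ : ∀ {k} (f g : Fin k → ℚ) → sumℚ (λ i → f i ℚ.+ g i) ≡ sumℚ f ℚ.+ sumℚ g
sumℚ-+ f g = trans (sumℚ≗sum (λ i → f i ℚ.+ g i))
                   (trans (ΣQ.∑-distrib-+ f g) (sym (cong₂ ℚ._+_ (sumℚ≗sum f) (sumℚ≗sum g))))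

sumℚ-remove : ∀ {k} (j : Fin (suc k)) (f : Fin (suc k) → ℚ) → sumℚ f ≡ f j ℚ.+ sumℚ (f ∘ punchIn j)
sumℚ-remove j f = trans (sumℚ≗sum f)
                        (trans (ΣQ.sum-remove {i = j} f) (cong (f j ℚ.+_) (sym (sumℚ≗sum (f ∘ punchIn j)))))

sumℤ-remove : ∀ {k} (j : Fin (suc k)) (f : Fin (suc k) → ℤ) → sumℤ f ≡ f j ℤ.+ sumℤ (f ∘ punchIn j)
sumℤ-remove j f = trans (sumℤ≗sum f)
                        (trans (ΣZ.sum-remove {i = j} f) (cong (ℤ._+_ (f j)) (sym (sumℤ≗sum (f ∘ punchIn j)))))

sumℚ-zero : ∀ k → sumℚ {k} (λ _ → 0ℚ) ≡ 0ℚ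
sumℚ-zero k = trans (sumℚ≗sum {k} (λ _ → 0ℚ)) (ΣQ.sum-replicate-zero k)

sumℚ-single : ∀ {k} (j : Fin k) (f : Fin k → ℚ) → (∀ i → i ≢ j → f i ≡ 0ℚ) → sumℚ f ≡ f j
sumℚ-single {suc k} j f f≡0 = begin
  sumℚ f                          ≡⟨ sumℚ-remove j f ⟩
  f j ℚ.+ sumℚ (f ∘ punchIn j)    ≡⟨ cong (f j ℚ.+_) (sumℚ-cong (λ i → f≡0 _ (punchInᵢ≢i j i))) ⟩
  f j ℚ.+ sumℚ {k} (λ _ → 0ℚ)     ≡⟨ cong (f j ℚ.+_) (sumℚ-zero k) ⟩
  f j ℚ.+ 0ℚ                      ≡⟨ ℚP.+-identityʳ (f j) ⟩
  f j                             ∎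

module ℤGroup = GroupProperties (AbelianGroup.group ℤP.+-0-abelianGroup)

sumℤ-cancel-off : ∀ {k} (j : Fin k) {f g : Fin k → ℤ} →
                  (∀ i → i ≢ j → f i ≡ g i) → sumℤ f ≡ sumℤ g → f j ≡ g j
sumℤ-cancel-off {suc k} j {f} {g} f≗g Σf≡Σg = ℤGroup.∙-cancelʳ (sumℤ (g ∘ punchIn j)) (f j) (g j) (begin
  f j ℤ.+ sumℤ (g ∘ punchIn j)    ≡⟨ cong (ℤ._+_ (f j)) (sumℤ-cong (λ i → f≗g _ (punchInᵢ≢i j i))) ⟨
  f j ℤ.+ sumℤ (f ∘ punchIn j)    ≡⟨ sumℤ-remove j f ⟨
  sumℤ f                          ≡⟨ Σf≡Σg ⟩
  sumℤ g                          ≡⟨ sumℤ-remove j g ⟩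
  g j ℤ.+ sumℤ (g ∘ punchIn j)    ∎)

-- Uniqueness of dimension

module ℚGroup = GroupProperties (AbelianGroup.group ℚP.+-0-abelianGroup)

Independent : ∀ {n d} → (Fin d → Vecℚ n) → Set
Independent b = ∀ c → (∀ j → lincomb c b j ≡ 0ℚ) → ∀ i → c i ≡ 0ℚ

lincomb-cong : ∀ {n d} {c c' : Fin d → ℚ} (b : Fin d → Vecℚ n) j → c ≗ c' → lincomb c b j ≡ lincomb c' b j
lincomb-cong b j c≗c' = sumℚ-cong (λ i → cong (ℚ._* b i j) (c≗c' i))

lincomb-+ : ∀ {n d} (c c' : Fin d → ℚ) (b : Fin d → Vecℚ n) j →
            lincomb (λ i → c i ℚ.+ c' i) b j ≡ lincomb c b j ℚ.+ lincomb c' b j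
lincomb-+ c c' b j = trans (sumℚ-cong (λ i → ℚP.*-distribʳ-+ (b i j) (c i) (c' i)))
                           (sumℚ-+ (λ i → c i ℚ.* b i j) (λ i → c' i ℚ.* b i j))

independent⇒coefficients-unique : ∀ {n d} {b : Fin d → Vecℚ n} → Independent b → (c c' : Fin d → ℚ) →
                                  (∀ j → lincomb c b j ≡ lincomb c' b j) → ∀ i → c i ≡ c' i
independent⇒coefficients-unique {b = b} ind c c' c≡c' i =
  ℚGroup.x∙y⁻¹≈ε⇒x≈y (c i) (c' i) (ind (λ i → c i ℚ.- c' i) difference≡0 i)
  where
  difference≡0 : ∀ j → lincomb (λ i → c i ℚ.- c' i) b j ≡ 0ℚ
  difference≡0 j = ℚGroup.identityˡ-unique _ _ (begin
    lincomb (λ i → c i ℚ.- c' i) b j ℚ.+ lincomb c' b j  ≡⟨ lincomb-+ (λ i → c i ℚ.- c' i) c' b j ⟨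
    lincomb (λ i → (c i ℚ.- c' i) ℚ.+ c' i) b j         ≡⟨ lincomb-cong b j (λ i → ℚGroup.//-rightDividesˡ (c' i) (c i)) ⟩
    lincomb c b j                                        ≡⟨ c≡c' j ⟩
    lincomb c' b j                                       ∎)

δ : ∀ {d} → Fin d → Fin d → ℚ
δ i l = if does (i ≟ l) then 1ℚ else 0ℚ

δ-diagonal : ∀ {d} (i : Fin d) → δ i i ≡ 1ℚ
δ-diagonal i = cong (λ x → if x then 1ℚ else 0ℚ) (dec-true (i ≟ i) refl)

δ-off-diagonal : ∀ {d} {i l : Fin d} → i ≢ l → δ i l ≡ 0ℚ
δ-off-diagonal {i = i} {l} i≢l = cong (λ x → if x then 1ℚ else 0ℚ) (dec-false (i ≟ l) i≢l)

lincomb-δ : ∀ {n d} (b : Fin d → Vecℚ n) i j → lincomb (δ i) b j ≡ b i j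
lincomb-δ b i j = begin
  lincomb (δ i) b j   ≡⟨ sumℚ-single i (λ l → δ i l ℚ.* b l j) off-diagonal ⟩
  δ i i ℚ.* b i j     ≡⟨ cong (ℚ._* b i j) (δ-diagonal i) ⟩
  1ℚ ℚ.* b i j        ≡⟨ ℚP.*-identityˡ (b i j) ⟩
  b i j               ∎
  where
  off-diagonal : ∀ l → l ≢ i → δ i l ℚ.* b l j ≡ 0ℚ
  off-diagonal l l≢i = trans (cong (ℚ._* b l j) (δ-off-diagonal (l≢i ∘ sym))) (ℚP.*-zeroˡ (b l j))

_*ᴹ_ : ∀ {d e f} → (Fin d → Fin e → ℚ) → (Fin e → Fin f → ℚ) → Fin d → Fin f → ℚ
(C *ᴹ D) i l = sumℚ (λ k → C i k ℚ.* D k l)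

trace : ∀ {d} → (Fin d → Fin d → ℚ) → ℚ
trace M = sumℚ (λ i → M i i)

trace-*ᴹ-comm : ∀ {d e} (C : Fin d → Fin e → ℚ) (D : Fin e → Fin d → ℚ) → trace (C *ᴹ D) ≡ trace (D *ᴹ C)
trace-*ᴹ-comm C D = trans (sumℚ-comm (λ i k → C i k ℚ.* D k i))
                          (sumℚ-cong (λ k → sumℚ-cong (λ i → ℚP.*-comm (C i k) (D k i))))

lincomb-lincomb : ∀ {n d e} (c : Fin e → ℚ) (D : Fin e → Fin d → ℚ) (b : Fin d → Vecℚ n) j →
                  lincomb c (λ k → lincomb (D k) b) j ≡ lincomb (λ l → sumℚ (λ k → c k ℚ.* D k l)) b j
lincomb-lincomb c D b j = begin
  sumℚ (λ k → c k ℚ.* sumℚ (λ l → D k l ℚ.* b l j))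
    ≡⟨ sumℚ-cong (λ k → sumℚ-*ˡ (c k) (λ l → D k l ℚ.* b l j)) ⟩
  sumℚ (λ k → sumℚ (λ l → c k ℚ.* (D k l ℚ.* b l j)))
    ≡⟨ sumℚ-cong (λ k → sumℚ-cong (λ l → ℚP.*-assoc (c k) (D k l) (b l j))) ⟨
  sumℚ (λ k → sumℚ (λ l → c k ℚ.* D k l ℚ.* b l j))
    ≡⟨ sumℚ-comm (λ k l → c k ℚ.* D k l ℚ.* b l j) ⟩
  sumℚ (λ l → sumℚ (λ k → c k ℚ.* D k l ℚ.* b l j))
    ≡⟨ sumℚ-cong (λ l → sumℚ-*ʳ (b l j) (λ k → c k ℚ.* D k l)) ⟨
  sumℚ (λ l → sumℚ (λ k → c k ℚ.* D k l) ℚ.* b l j)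
    ∎

change-of-basis-diagonal : ∀ {n d e} {b : Fin d → Vecℚ n} {b' : Fin e → Vecℚ n}
  (C : Fin d → Fin e → ℚ) (D : Fin e → Fin d → ℚ) → Independent b →
  (∀ i j → b i j ≡ lincomb (C i) b' j) → (∀ k j → b' k j ≡ lincomb (D k) b j) →
  ∀ i → (C *ᴹ D) i i ≡ 1ℚ
change-of-basis-diagonal {b = b} {b'} C D ind b≡Cb' b'≡Db i =
  trans (independent⇒coefficients-unique ind ((C *ᴹ D) i) (δ i) represents-b i) (δ-diagonal i)
  where
  represents-b : ∀ j → lincomb ((C *ᴹ D) i) b j ≡ lincomb (δ i) b j
  represents-b j = begin
    lincomb ((C *ᴹ D) i) b j                   ≡⟨ lincomb-lincomb (C i) D b j ⟨
    lincomb (C i) (λ k → lincomb (D k) b) j    ≡⟨ sumℚ-cong (λ k → cong (C i k ℚ.*_) (b'≡Db k j)) ⟨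
    lincomb (C i) b' j                         ≡⟨ b≡Cb' i j ⟨
    b i j                                      ≡⟨ lincomb-δ b i j ⟨
    lincomb (δ i) b j                          ∎

ofℕ : ℕ → ℚ
ofℕ d = sumℚ {d} (λ _ → 1ℚ)

0<1 : 0ℚ ℚ.< 1ℚ
0<1 = ℚ.*<* (ℤ.+<+ (ℕ.s≤s ℕ.z≤n))

ofℕ-nonneg : ∀ d → 0ℚ ℚ.≤ ofℕ d
ofℕ-nonneg zero    = ℚP.≤-refl
ofℕ-nonneg (suc d) = ℚP.+-mono-≤ (ℚP.<⇒≤ 0<1) (ofℕ-nonneg d)

ofℕ-suc-pos : ∀ d → 0ℚ ℚ.< ofℕ (suc d)
ofℕ-suc-pos d = ℚP.+-mono-<-≤ 0<1 (ofℕ-nonneg d)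

ofℕ-injective : ∀ {d e} → ofℕ d ≡ ofℕ e → d ≡ e
ofℕ-injective {zero}  {zero}  _  = refl
ofℕ-injective {zero}  {suc e} eq = contradiction eq (ℚP.<⇒≢ (ofℕ-suc-pos e))
ofℕ-injective {suc d} {zero}  eq = contradiction (sym eq) (ℚP.<⇒≢ (ofℕ-suc-pos d))
ofℕ-injective {suc d} {suc e} eq = cong suc (ofℕ-injective (ℚGroup.∙-cancelˡ 1ℚ (ofℕ d) (ofℕ e) eq))

-- d = trace (C D) = trace (D C) = e for the change-of-basis matrices C and D.
HasDim-unique : ∀ {n} {X : Subset n} {d e} → HasDim X d → HasDim X e → d ≡ e
HasDim-unique {d = d} {e} (b , b∈X , b-ind , b-span) (b' , b'∈X , b'-ind , b'-span) = ofℕ-injective (begin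
  ofℕ d           ≡⟨ sumℚ-cong (change-of-basis-diagonal C D b-ind b≡Cb' b'≡Db) ⟨
  trace (C *ᴹ D)  ≡⟨ trace-*ᴹ-comm C D ⟩
  trace (D *ᴹ C)  ≡⟨ sumℚ-cong (change-of-basis-diagonal D C b'-ind b'≡Db b≡Cb') ⟩
  ofℕ e           ∎)
  where
  C : Fin d → Fin e → ℚ
  C i = proj₁ (b'-span (b i) (b∈X i))
  b≡Cb' : ∀ i j → b i j ≡ lincomb (C i) b' j
  b≡Cb' i = proj₂ (b'-span (b i) (b∈X i))
  D : Fin e → Fin d → ℚ
  D k = proj₁ (b-span (b' k) (b'∈X k))
  b'≡Db : ∀ k j → b' k j ≡ lincomb (D k) b j
  b'≡Db k = proj₂ (b-span (b' k) (b'∈X k))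

-- Uniqueness of the Möbius function

module MöbiusUniqueness {m} (le : Fin m → Fin m → Bool)
  (le-refl : ∀ i → le i i ≡ true)
  (le-trans : ∀ {i j k} → le i j ≡ true → le j k ≡ true → le i k ≡ true)
  (le-antisym : ∀ {i j} → le i j ≡ true → le j i ≡ true → i ≡ j)
  (bottom : Fin m) where

  summand : (Fin m → ℤ) → Fin m → Fin m → ℤ
  summand μ j i = if le i j then μ i else ℤ.0ℤ

  IsMöbius : (Fin m → ℤ) → Set
  IsMöbius μ = μ bottom ≡ ℤ.1ℤ × (∀ j → j ≢ bottom → sumℤ (summand μ j) ≡ ℤ.0ℤ)

  below : Fin m → Fs.Subset m
  below j = tabulate (λ i → le i j)

  ∈-below⁺ : ∀ {i j} → le i j ≡ true → i Fs.∈ below j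
  ∈-below⁺ {i} {j} i≤j = lookup⇒[]= i (below j) (trans (lookup∘tabulate (λ i → le i j) i) i≤j)

  ∈-below⁻ : ∀ {i j} → i Fs.∈ below j → le i j ≡ true
  ∈-below⁻ {i} {j} i∈ = trans (sym (lookup∘tabulate (λ i → le i j) i)) ([]=⇒lookup i∈)

  below-⊂ : ∀ {i j} → le i j ≡ true → i ≢ j → below i Fs.⊂ below j
  below-⊂ {i} {j} i≤j i≢j =
    (λ x∈ → ∈-below⁺ (le-trans (∈-below⁻ x∈) i≤j)) ,
    j , ∈-below⁺ (le-refl j) , λ j∈ → i≢j (le-antisym i≤j (∈-below⁻ j∈))

  _≺_ : Fin m → Fin m → Set
  _≺_ = _<_ on (Fs.∣_∣ ∘ below)

  ≺-wellFounded : WellFounded _≺_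
  ≺-wellFounded = On.wellFounded (Fs.∣_∣ ∘ below) <-wellFounded

  möbius-unique : ∀ {μ μ'} → IsMöbius μ → IsMöbius μ' → ∀ j → μ j ≡ μ' j
  möbius-unique {μ} {μ'} (μ-bottom , μ-sum) (μ'-bottom , μ'-sum) =
    WF.All.wfRec ≺-wellFounded _ (λ j → μ j ≡ μ' j) step
    where
    step : ∀ j → (∀ {i} → i ≺ j → μ i ≡ μ' i) → μ j ≡ μ' j
    step j ih with j ≟ bottom
    ... | yes refl = trans μ-bottom (sym μ'-bottom)
    ... | no j≢bottom = subst (λ b → (if b then μ j else ℤ.0ℤ) ≡ (if b then μ' j else ℤ.0ℤ)) (le-refl j)
            (sumℤ-cancel-off j off-diagonal (trans (μ-sum j j≢bottom) (sym (μ'-sum j j≢bottom))))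
      where
      off-diagonal : ∀ i → i ≢ j → summand μ j i ≡ summand μ' j i
      off-diagonal i i≢j with le i j in i≤j
      ... | true  = ih (p⊂q⇒∣p∣<∣q∣ (below-⊂ i≤j i≢j))
      ... | false = refl

-- Characteristic polynomials of isomorphic intersection posets

≃-sym : ∀ {n} {X Y : Subset n} → X ≃ Y → Y ≃ X
≃-sym (X⊆Y , Y⊆X) = Y⊆X , X⊆Y

≃-trans : ∀ {n} {X Y Z : Subset n} → X ≃ Y → Y ≃ Z → X ≃ Z
≃-trans (X⊆Y , Y⊆X) (Y⊆Z , Z⊆Y) = (λ x → Y⊆Z x ∘ X⊆Y x) , (λ x → Y⊆X x ∘ Z⊆Y x)

InL-Full : ∀ {n} (A : Arrangement n) → InL A Full
InL-Full A = [] , All.[] , (λ _ _ → All.[]) , (λ _ _ → tt)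

module CharPolyWitness {n} {A : Arrangement n} {p : ℕ → ℤ} (P : IsCharPoly A p) where
  open IsCharPoly P

  le-refl : ∀ i → le i i ≡ true
  le-refl i = le-compl i i (λ _ x∈ → x∈)

  le-trans : ∀ {i j k} → le i j ≡ true → le j k ≡ true → le i k ≡ true
  le-trans {i} {j} {k} i≤j j≤k = le-compl i k (λ x → le-sound i j i≤j x ∘ le-sound j k j≤k x)

  le-antisym : ∀ {i j} → le i j ≡ true → le j i ≡ true → i ≡ j
  le-antisym {i} {j} i≤j j≤i = flat-inj i j (le-sound j i j≤i , le-sound i j i≤j)

  full : Fin m
  full = proj₁ (flat-all Full (InL-Full A))

  full-flat : flat full ≃ Full
  full-flat = ≃-sym (proj₂ (flat-all Full (InL-Full A)))

  full-unique : ∀ {i} → flat i ≃ Full → i ≡ full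
  full-unique {i} i-full = flat-inj i full (≃-trans i-full (≃-sym full-flat))

  IsLeast : Fin m → Set
  IsLeast i = ∀ j → le i j ≡ true

  full⇒least : ∀ {i} → flat i ≃ Full → IsLeast i
  full⇒least {i} i-full j = le-compl i j (λ x _ → proj₂ i-full x tt)

  least⇒full : ∀ {i} → IsLeast i → flat i ≃ Full
  least⇒full {i} i-least = (λ _ _ → tt) , (λ x _ → le-sound i full (i-least full) x (proj₂ full-flat x tt))

  open MöbiusUniqueness le le-refl le-trans le-antisym full public using (IsMöbius; möbius-unique)

  μ-isMöbius : IsMöbius μ
  μ-isMöbius = μ-bot full full-flat , λ j j≢full → μ-rec j (j≢full ∘ full-unique)

module _ {n} {A₁ A₂ : Arrangement n} {p₁ p₂ : ℕ → ℤ} (P₁ : IsCharPoly A₁ p₁) (P₂ : IsCharPoly A₂ p₂) where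
  private
    module P₁ = IsCharPoly P₁
    module P₂ = IsCharPoly P₂
    module W₁ = CharPolyWitness P₁
    module W₂ = CharPolyWitness P₂

  order-isomorphism⇒μ-preserved : (π : Permutation P₁.m P₂.m) →
    (∀ i j → P₂.le (π ⟨$⟩ʳ i) (π ⟨$⟩ʳ j) ≡ P₁.le i j) → ∀ i → P₁.μ i ≡ P₂.μ (π ⟨$⟩ʳ i)
  order-isomorphism⇒μ-preserved π le-preserved = W₁.möbius-unique W₁.μ-isMöbius μ₂∘π-isMöbius
    where
    π-least : ∀ {i} → W₁.IsLeast i → W₂.IsLeast (π ⟨$⟩ʳ i)
    π-least {i} i-least j = begin
      P₂.le (π ⟨$⟩ʳ i) j                     ≡⟨ cong (P₂.le (π ⟨$⟩ʳ i)) (inverseʳ π) ⟨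
      P₂.le (π ⟨$⟩ʳ i) (π ⟨$⟩ʳ (π ⟨$⟩ˡ j))   ≡⟨ le-preserved i (π ⟨$⟩ˡ j) ⟩
      P₁.le i (π ⟨$⟩ˡ j)                     ≡⟨ i-least (π ⟨$⟩ˡ j) ⟩
      true                                   ∎

    π-least⁻ : ∀ {i} → W₂.IsLeast (π ⟨$⟩ʳ i) → W₁.IsLeast i
    π-least⁻ {i} πi-least j = trans (sym (le-preserved i j)) (πi-least (π ⟨$⟩ʳ j))

    sum≡0 : ∀ j → j ≢ W₁.full → sumℤ (λ i → if P₁.le i j then P₂.μ (π ⟨$⟩ʳ i) else ℤ.0ℤ) ≡ ℤ.0ℤ
    sum≡0 j j≢full = begin
      sumℤ (λ i → if P₁.le i j then P₂.μ (π ⟨$⟩ʳ i) else ℤ.0ℤ)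
        ≡⟨ sumℤ-cong (λ i → cong (λ b → if b then P₂.μ (π ⟨$⟩ʳ i) else ℤ.0ℤ) (le-preserved i j)) ⟨
      sumℤ (λ i → if P₂.le (π ⟨$⟩ʳ i) (π ⟨$⟩ʳ j) then P₂.μ (π ⟨$⟩ʳ i) else ℤ.0ℤ)
        ≡⟨ sumℤ-permute (λ i → if P₂.le i (π ⟨$⟩ʳ j) then P₂.μ i else ℤ.0ℤ) π ⟨
      sumℤ (λ i → if P₂.le i (π ⟨$⟩ʳ j) then P₂.μ i else ℤ.0ℤ)
        ≡⟨ P₂.μ-rec (π ⟨$⟩ʳ j) (j≢full ∘ W₁.full-unique ∘ W₁.least⇒full ∘ π-least⁻ ∘ W₂.full⇒least) ⟩
      ℤ.0ℤ
        ∎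

    μ₂∘π-isMöbius : W₁.IsMöbius (P₂.μ ∘ (π ⟨$⟩ʳ_))
    μ₂∘π-isMöbius = P₂.μ-bot _ (W₂.least⇒full (π-least (W₁.full⇒least W₁.full-flat))) , sum≡0

  rank-preserving-isomorphism⇒charPoly-≡ : (π : Permutation P₁.m P₂.m) →
    (∀ i j → P₂.le (π ⟨$⟩ʳ i) (π ⟨$⟩ʳ j) ≡ P₁.le i j) → (∀ i → P₂.dim (π ⟨$⟩ʳ i) ≡ P₁.dim i) →
    ∀ d → p₁ d ≡ p₂ d
  rank-preserving-isomorphism⇒charPoly-≡ π le-preserved dim-preserved d = begin
    p₁ d
      ≡⟨ P₁.coeff d ⟩
    sumℤ (λ i → if P₁.dim i ≡ᵇ d then P₁.μ i else ℤ.0ℤ)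
      ≡⟨ sumℤ-cong (λ i → cong₂ (λ e x → if e ≡ᵇ d then x else ℤ.0ℤ)
                                (sym (dim-preserved i)) (order-isomorphism⇒μ-preserved π le-preserved i)) ⟩
    sumℤ (λ i → if P₂.dim (π ⟨$⟩ʳ i) ≡ᵇ d then P₂.μ (π ⟨$⟩ʳ i) else ℤ.0ℤ)
      ≡⟨ sumℤ-permute (λ i → if P₂.dim i ≡ᵇ d then P₂.μ i else ℤ.0ℤ) π ⟨
    sumℤ (λ i → if P₂.dim i ≡ᵇ d then P₂.μ i else ℤ.0ℤ)
      ≡⟨ P₂.coeff d ⟨
    p₂ d
      ∎

permute : ∀ {n} → Permutation n n → Vecℚ n → Vecℚ n
permute σ x j = x (σ ⟨$⟩ʳ j)

image : ∀ {n} → Permutation n n → Subset n → Subset n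
image σ X y = X (permute (flip σ) y)

MapsInto : ∀ {n} → Permutation n n → Arrangement n → Arrangement n → Set
MapsInto σ A B = ∀ a → A a → B (permute σ a)

dot-permute : ∀ {n} (σ : Permutation n n) a y → dot (permute σ a) y ≡ dot a (permute (flip σ) y)
dot-permute σ a y = begin
  sumℚ (λ j → a (σ ⟨$⟩ʳ j) ℚ.* y j)
    ≡⟨ sumℚ-cong (λ j → cong (λ i → a (σ ⟨$⟩ʳ j) ℚ.* y i) (inverseˡ σ)) ⟨
  sumℚ (λ j → a (σ ⟨$⟩ʳ j) ℚ.* y (σ ⟨$⟩ˡ (σ ⟨$⟩ʳ j)))
    ≡⟨ sumℚ-permute (λ j → a j ℚ.* y (σ ⟨$⟩ˡ j)) σ ⟨
  sumℚ (λ j → a j ℚ.* y (σ ⟨$⟩ˡ j))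
    ∎

image-≃ : ∀ {n} (σ : Permutation n n) {X Y : Subset n} → X ≃ Y → image σ X ≃ image σ Y
image-≃ σ (X⊆Y , Y⊆X) = (λ y → X⊆Y _) , (λ y → Y⊆X _)

image-Inter : ∀ {n} (σ : Permutation n n) as → image σ (Inter as) ≃ Inter (map (permute σ) as)
image-Inter σ as =
  (λ y → map⁺ ∘ All.map (λ {a} → trans (dot-permute σ a y))) ,
  (λ y → All.map (λ {a} → trans (sym (dot-permute σ a y))) ∘ map⁻)

InL-image : ∀ {n} (σ : Permutation n n) {A B : Arrangement n} {X : Subset n} →
            MapsInto σ A B → InL A X → InL B (image σ X)
InL-image σ A⇒B (as , as∈A , X≃as) =
  map (permute σ) as , map⁺ (All.map (A⇒B _) as∈A) , ≃-trans (image-≃ σ X≃as) (image-Inter σ as)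

Inter-respects-≗ : ∀ {n} (as : List (Vecℚ n)) → Inter as Respects _≗_
Inter-respects-≗ as x≗y = All.map (λ {a} → trans (sumℚ-cong (λ j → cong (a j ℚ.*_) (sym (x≗y j)))))

InL-respects-≗ : ∀ {n} {A : Arrangement n} {X : Subset n} → InL A X → X Respects _≗_
InL-respects-≗ (as , _ , X⊆as , as⊆X) x≗y = as⊆X _ ∘ Inter-respects-≗ as x≗y ∘ X⊆as _

image-flip-image : ∀ {n} (σ : Permutation n n) {X : Subset n} → X Respects _≗_ →
                   image (flip σ) (image σ X) ≃ X
image-flip-image σ X-resp = (λ y → X-resp (λ j → cong y (inverseʳ σ)))
                          , (λ y → X-resp (λ j → cong y (sym (inverseʳ σ))))

HasDim-≃ : ∀ {n} {X Y : Subset n} {d} → HasDim X d → X ≃ Y → HasDim Y d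
HasDim-≃ (b , b∈X , b-ind , b-span) (X⊆Y , Y⊆X) = b , (λ i → X⊆Y _ (b∈X i)) , b-ind , (λ y → b-span y ∘ Y⊆X y)

HasDim-image : ∀ {n} (σ : Permutation n n) {X : Subset n} {d} → X Respects _≗_ →
               HasDim X d → HasDim (image σ X) d
HasDim-image σ X-resp (b , b∈X , b-ind , b-span) =
  permute σ ∘ b ,
  (λ k → X-resp (λ j → cong (b k) (sym (inverseʳ σ))) (b∈X k)) ,
  (λ c Σ≡0 → b-ind c (λ j → subst (λ i → lincomb c b i ≡ 0ℚ) (inverseʳ σ) (Σ≡0 (σ ⟨$⟩ˡ j)))) ,
  λ y y∈ → let (c , y≡) = b-span _ y∈ in
    c , (λ j → trans (cong y (sym (inverseˡ σ))) (y≡ (σ ⟨$⟩ʳ j)))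

module FlatImage {n} {A₁ A₂ : Arrangement n} {p₁ p₂ : ℕ → ℤ} (P₁ : IsCharPoly A₁ p₁) (P₂ : IsCharPoly A₂ p₂)
  (σ : Permutation n n) (A₁⇒A₂ : MapsInto σ A₁ A₂) where
  private
    module P₁ = IsCharPoly P₁
    module P₂ = IsCharPoly P₂

  flatImage : Fin P₁.m → Fin P₂.m
  flatImage i = proj₁ (P₂.flat-all _ (InL-image σ A₁⇒A₂ (P₁.flat-in i)))

  flatImage-≃ : ∀ i → image σ (P₁.flat i) ≃ P₂.flat (flatImage i)
  flatImage-≃ i = proj₂ (P₂.flat-all _ (InL-image σ A₁⇒A₂ (P₁.flat-in i)))

  flatImage-le : ∀ {i j} → P₁.le i j ≡ true → P₂.le (flatImage i) (flatImage j) ≡ true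
  flatImage-le {i} {j} i≤j = P₂.le-compl _ _
    (λ y → proj₁ (flatImage-≃ i) y ∘ P₁.le-sound i j i≤j _ ∘ proj₂ (flatImage-≃ j) y)

  flatImage-dim : ∀ i → P₂.dim (flatImage i) ≡ P₁.dim i
  flatImage-dim i = HasDim-unique (P₂.dim-ok (flatImage i))
    (HasDim-≃ (HasDim-image σ (InL-respects-≗ (P₁.flat-in i)) (P₁.dim-ok i)) (flatImage-≃ i))

flatImage-inverse : ∀ {n} {A₁ A₂ : Arrangement n} {p₁ p₂ : ℕ → ℤ} (P₁ : IsCharPoly A₁ p₁) (P₂ : IsCharPoly A₂ p₂)
  (σ : Permutation n n) (A₁⇒A₂ : MapsInto σ A₁ A₂) (A₂⇒A₁ : MapsInto (flip σ) A₂ A₁) →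
  ∀ i → FlatImage.flatImage P₂ P₁ (flip σ) A₂⇒A₁ (FlatImage.flatImage P₁ P₂ σ A₁⇒A₂ i) ≡ i
flatImage-inverse P₁ P₂ σ A₁⇒A₂ A₂⇒A₁ i = IsCharPoly.flat-inj P₁ _ i
  (≃-trans (≃-sym (B.flatImage-≃ (F.flatImage i)))
  (≃-trans (image-≃ (flip σ) (≃-sym (F.flatImage-≃ i)))
           (image-flip-image σ (InL-respects-≗ (IsCharPoly.flat-in P₁ i)))))
  where
  module F = FlatImage P₁ P₂ σ A₁⇒A₂
  module B = FlatImage P₂ P₁ (flip σ) A₂⇒A₁

≡true-⇔⇒≡ : ∀ {a b : Bool} → (a ≡ true → b ≡ true) → (b ≡ true → a ≡ true) → a ≡ b
≡true-⇔⇒≡ {false} {false} _   _   = refl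
≡true-⇔⇒≡ {false} {true}  _   b⇒a = b⇒a refl
≡true-⇔⇒≡ {true}  {false} a⇒b _   = sym (a⇒b refl)
≡true-⇔⇒≡ {true}  {true}  _   _   = refl

coordinate-permutation⇒charPoly-≡ : ∀ {n} {A₁ A₂ : Arrangement n} {p₁ p₂ : ℕ → ℤ} →
  IsCharPoly A₁ p₁ → IsCharPoly A₂ p₂ →
  (σ : Permutation n n) → MapsInto σ A₁ A₂ → MapsInto (flip σ) A₂ A₁ → ∀ d → p₁ d ≡ p₂ d
coordinate-permutation⇒charPoly-≡ P₁ P₂ σ A₁⇒A₂ A₂⇒A₁ =
  rank-preserving-isomorphism⇒charPoly-≡ P₁ P₂ π le-preserved F.flatImage-dim
  where
  module F = FlatImage P₁ P₂ σ A₁⇒A₂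
  module B = FlatImage P₂ P₁ (flip σ) A₂⇒A₁

  B∘F≗id : ∀ i → B.flatImage (F.flatImage i) ≡ i
  B∘F≗id = flatImage-inverse P₁ P₂ σ A₁⇒A₂ A₂⇒A₁

  π : Permutation (IsCharPoly.m P₁) (IsCharPoly.m P₂)
  π = permutation F.flatImage B.flatImage (flatImage-inverse P₂ P₁ (flip σ) A₂⇒A₁ A₁⇒A₂) B∘F≗id

  le-preserved : ∀ i j → IsCharPoly.le P₂ (F.flatImage i) (F.flatImage j) ≡ IsCharPoly.le P₁ i j
  le-preserved i j = ≡true-⇔⇒≡
    (subst₂ (λ i j → IsCharPoly.le P₁ i j ≡ true) (B∘F≗id i) (B∘F≗id j) ∘ B.flatImage-le)
    F.flatImage-le

altForm-renumber : ∀ G (N M : Numeration G) → Injective _≡_ _≡_ N → Injective _≡_ _≡_ M →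
                   ∀ k r e → altForm G N k r (N e) ≡ altForm G M k r (M e)
altForm-renumber G N M N-inj M-inj k r e = sumℚ-cong (λ i →
  cong (λ b → sgn (toℕ i) ℚ.* (if b then 1ℚ else 0ℚ))
       (does-⇔ (mk⇔ (cong M ∘ N-inj) (cong N ∘ M-inj)) (N (r i) ≟ N e) (M (r i) ≟ M e)))

MA-renumber : ∀ G (ν μ : Permutation (nE G) (nE G)) → MapsInto (flip μ ∘ₚ ν) (MA G (ν ⟨$⟩ʳ_)) (MA G (μ ⟨$⟩ʳ_))
MA-renumber G ν μ a (k , r , r∈F , a≡) = k , r , r∈F , λ j → begin
  a (ν ⟨$⟩ʳ (μ ⟨$⟩ˡ j))                          ≡⟨ a≡ _ ⟩
  altForm G (ν ⟨$⟩ʳ_) k r (ν ⟨$⟩ʳ (μ ⟨$⟩ˡ j))    ≡⟨ altForm-renumber G _ _ (injective ν) (injective μ) k r (μ ⟨$⟩ˡ j) ⟩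
  altForm G (μ ⟨$⟩ʳ_) k r (μ ⟨$⟩ʳ (μ ⟨$⟩ˡ j))    ≡⟨ cong (altForm G (μ ⟨$⟩ʳ_) k r) (inverseʳ μ) ⟩
  altForm G (μ ⟨$⟩ʳ_) k r j                      ∎
  where
  injective : (π : Permutation (nE G) (nE G)) → Injective _≡_ _≡_ (π ⟨$⟩ʳ_)
  injective π = Injection.injective (↔⇒↣ π)

theorem3 : (G : SimpleGraph) (N₁ N₂ : Numeration G) →
    Bijective _≡_ _≡_ N₁ → Bijective _≡_ _≡_ N₂ →
    (p₁ p₂ : ℕ → ℤ) → IsCharPoly (MA G N₁) p₁ → IsCharPoly (MA G N₂) p₂ →
    ∀ d → p₁ d ≡ p₂ d
theorem3 G N₁ N₂ N₁-bij N₂-bij p₁ p₂ P₁ P₂ =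
  coordinate-permutation⇒charPoly-≡ P₁ P₂ (flip ν₂ ∘ₚ ν₁) (MA-renumber G ν₁ ν₂) (MA-renumber G ν₂ ν₁)
  where
  ν₁ ν₂ : Permutation (nE G) (nE G)
  ν₁ = ⤖⇒↔ (mk⤖ N₁-bij)
  ν₂ = ⤖⇒↔ (mk⤖ N₂-bij)
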